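{- Let $k,m$ be positive integers, $n=k+m$, let $Q$ be the complete bipartite poset of type $(k,m)$, $A=\{x_{k+1},\dots,x_n\}$ and $M=\mathbf{I}(Q,A)$. If $X,Y\in E(M)$, then $X\sim_o Y$ in $E(M)$; that is, there exist $Z,W\in E(M)$ with $XZ=ZY$ and $YW=WX$.
   Context: Work over $\mathbb{C}$. The complete bipartite poset of type $(k,m)$ is $Q=\{x_1,\dots,x_n\}$ with $x_i<x_j$ iff $i\le k<j$, no other strict relations. $M=\mathbf{I}(Q,A)=\{\begin{bmatrix}\mathbf{1}_k&B\\0&D\end{bmatrix}: B\in\mathrm{Mat}_{k,m},\ D\text{ diagonal }m\times m\}$ is the Zariski closure of $\mathbf{T}_n(A)\ltimes\mathbf{U}_n(Q)$ (invertible diagonal matrices with first $k$ entries $1$, times upper unitriangular matrices supported on the relations of $Q$). $E(M)$ is the set of idempotents of $M$, which is a subsemigroup. For a semigroup $S$, $a\sim_o b$ means there exist $g,h\in S^1$ with $ag=gb$ and $bh=ha$. -}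

module Defs where

open import Level using (Level; _⊔_)
open import Data.Nat as ℕ using (ℕ; zero; suc; _<_; _≤_)
open import Data.Fin as Fin using (Fin; toℕ)
open import Data.Product using (_×_; Σ)
open import Relation.Nullary using (¬_)
open import Relation.Binary.PropositionalEquality using (_≡_)
open import Algebra.Bundles using (CommutativeRing)

record Field (c ℓ : Level) : Set (Level.suc (c ⊔ ℓ)) where
  field
    commutativeRing : CommutativeRing c ℓ
  open CommutativeRing commutativeRing public
  field
    1≉0     : ¬ (1# ≈ 0#)
    inverse : ∀ x → ¬ (x ≈ 0#) → Σ Carrier λ y → x * y ≈ 1#

module MatrixDefs {c ℓ : Level} (F : Field c ℓ) where
  open Field F

  -- n × n matrices over F, entries indexed by Fin n (row, column);
  -- index i : Fin n corresponds to the poset element x_{i+1}.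
  Mat : ℕ → Set c
  Mat n = Fin n → Fin n → Carrier

  _≈ᴹ_ : ∀ {n} → Mat n → Mat n → Set ℓ
  X ≈ᴹ Y = ∀ i j → X i j ≈ Y i j

  sumFin : ∀ n → (Fin n → Carrier) → Carrier
  sumFin zero    f = 0#
  sumFin (suc n) f = f Fin.zero + sumFin n (λ l → f (Fin.suc l))

  _⊗_ : ∀ {n} → Mat n → Mat n → Mat n
  _⊗_ {n} X Y i j = sumFin n (λ l → X i l * Y l j)

  -- M = I(Q, A) for the complete bipartite poset Q of type (k, m),
  -- A = {x_{k+1}, …, x_n}:  matrices [[1_k, B], [0, D]] with
  -- B arbitrary k × m and D diagonal m × m.
  InM : (k m : ℕ) → Mat (k ℕ.+ m) → Set ℓ
  InM k m X = ∀ (i j : Fin (k ℕ.+ m)) →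
      (toℕ i < k → toℕ j < k → i ≡ j → X i j ≈ 1#)
    × (toℕ i < k → toℕ j < k → ¬ (i ≡ j) → X i j ≈ 0#)
    × (k ≤ toℕ i → toℕ j < k → X i j ≈ 0#)
    × (k ≤ toℕ i → k ≤ toℕ j → ¬ (i ≡ j) → X i j ≈ 0#)

  Idempotent : ∀ {n} → Mat n → Set ℓ
  Idempotent X = (X ⊗ X) ≈ᴹ X

  InEM : (k m : ℕ) → Mat (k ℕ.+ m) → Set ℓ
  InEM k m X = InM k m X × Idempotent X

{-# OPTIONS --safe #-}
-- The witnesses are the "top halves" of the idempotents: for Y = [[1, B], [0, D]]
-- put Z = [[1, B], [0, 0]].  Every X ∈ M acts as the identity on such a Z from the
-- left, while Y² = Y forces B D = 0, so that Z Y = Z as well; hence X Z = Z = Z Y.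
module Submission where

open import Defs
open import Level using (Level)
open import Data.Nat using (ℕ; zero; suc; _+_; _≤_; _<_; _<?_)
import Data.Nat as ℕ
open import Data.Nat.Properties using (≤⇒≯; <-≤-connex)
open import Data.Fin using (Fin; toℕ) renaming (zero to fzero; suc to fsuc)
open import Data.Fin.Properties using (suc-injective)
open import Data.Product using (_×_; Σ; _,_; proj₁; proj₂)
open import Data.Sum using (inj₁; inj₂)
open import Relation.Nullary using (¬_; yes; no; contradiction)
import Relation.Binary.PropositionalEquality as P

module Sums {c ℓ : Level} (F : Field c ℓ) where
  open Field F
  open MatrixDefs F

  sumFin-cong : ∀ n {f g : Fin n → Carrier} → (∀ l → f l ≈ g l) → sumFin n f ≈ sumFin n g
  sumFin-cong zero    f≈g = refl
  sumFin-cong (suc n) f≈g = +-cong (f≈g fzero) (sumFin-cong n (λ l → f≈g (fsuc l)))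

  sumFin-zero : ∀ n {f : Fin n → Carrier} → (∀ l → f l ≈ 0#) → sumFin n f ≈ 0#
  sumFin-zero zero    f≈0 = refl
  sumFin-zero (suc n) f≈0 =
    trans (+-cong (f≈0 fzero) (sumFin-zero n (λ l → f≈0 (fsuc l)))) (+-identityʳ 0#)

  sumFin-single : ∀ n {f : Fin n → Carrier} (i : Fin n) →
                  (∀ l → ¬ l P.≡ i → f l ≈ 0#) → sumFin n f ≈ f i
  sumFin-single (suc n) fzero f≈0 =
    trans (+-cong refl (sumFin-zero n (λ l → f≈0 (fsuc l) λ ()))) (+-identityʳ _)
  sumFin-single (suc n) (fsuc i) f≈0 =
    trans (+-cong (f≈0 fzero λ ()) (sumFin-single n i λ l l≢i → f≈0 (fsuc l) (λ eq → l≢i (suc-injective eq))))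
          (+-identityˡ _)

module TopRows {c ℓ : Level} (F : Field c ℓ) (k m : ℕ) where
  open Field F
  open MatrixDefs F
  open Sums F
  open import Relation.Binary.Reasoning.Setoid setoid

  n : ℕ
  n = k ℕ.+ m

  topRows : Mat n → Mat n
  topRows Y i j with toℕ i <? k
  ... | yes _ = Y i j
  ... | no  _ = 0#

  topRows-< : ∀ Y {i} j → toℕ i < k → topRows Y i j ≈ Y i j
  topRows-< Y {i} j i<k with toℕ i <? k
  ... | yes _   = refl
  ... | no  i≮k = contradiction i<k i≮k

  topRows-≥ : ∀ Y {i} j → k ≤ toℕ i → topRows Y i j ≈ 0#
  topRows-≥ Y {i} j k≤i with toℕ i <? k
  ... | yes i<k = contradiction i<k (≤⇒≯ k≤i)
  ... | no  _   = refl

  topRows-cong : ∀ {X Y} → X ≈ᴹ Y → topRows X ≈ᴹ topRows Y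
  topRows-cong X≈Y i j with toℕ i <? k
  ... | yes _ = X≈Y i j
  ... | no  _ = refl

  topRows-InM : ∀ {Y} → InM k m Y → InM k m (topRows Y)
  topRows-InM {Y} Y∈M i j =
      (λ i<k j<k i≡j → trans (topRows-< Y j i<k) (proj₁ (Y∈M i j) i<k j<k i≡j))
    , (λ i<k j<k i≢j → trans (topRows-< Y j i<k) (proj₁ (proj₂ (Y∈M i j)) i<k j<k i≢j))
    , (λ k≤i _ → topRows-≥ Y j k≤i)
    , (λ k≤i _ _ → topRows-≥ Y j k≤i)

  topRows-⊗ : ∀ X Y → (topRows X ⊗ Y) ≈ᴹ topRows (X ⊗ Y)
  topRows-⊗ X Y i j with <-≤-connex (toℕ i) k
  ... | inj₁ i<k = begin
    (topRows X ⊗ Y) i j ≈⟨ sumFin-cong n (λ l → *-cong (topRows-< X l i<k) refl) ⟩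
    (X ⊗ Y) i j         ≈⟨ sym (topRows-< (X ⊗ Y) j i<k) ⟩
    topRows (X ⊗ Y) i j ∎
  ... | inj₂ k≤i = begin
    (topRows X ⊗ Y) i j ≈⟨ sumFin-zero n (λ l → trans (*-cong (topRows-≥ X l k≤i) refl) (zeroˡ _)) ⟩
    0#                  ≈⟨ sym (topRows-≥ (X ⊗ Y) j k≤i) ⟩
    topRows (X ⊗ Y) i j ∎

  -- Row l of topRows Y vanishes unless l < k, and in the first k columns X ∈ M has
  -- nonzero entries only on the diagonal.
  InM-⊗-topRows-diagonal : ∀ {X} → InM k m X → ∀ Y i j → (X ⊗ topRows Y) i j ≈ X i i * topRows Y i j
  InM-⊗-topRows-diagonal {X} X∈M Y i j = sumFin-single n i off-diagonal
    where
      off-diagonal : ∀ l → ¬ l P.≡ i → X i l * topRows Y l j ≈ 0#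
      off-diagonal l l≢i with <-≤-connex (toℕ l) k
      ... | inj₂ k≤l = trans (*-cong refl (topRows-≥ Y j k≤l)) (zeroʳ _)
      ... | inj₁ l<k with <-≤-connex (toℕ i) k
      ...   | inj₁ i<k = trans (*-cong (proj₁ (proj₂ (X∈M i l)) i<k l<k (λ i≡l → l≢i (P.sym i≡l))) refl) (zeroˡ _)
      ...   | inj₂ k≤i = trans (*-cong (proj₁ (proj₂ (proj₂ (X∈M i l))) k≤i l<k) refl) (zeroˡ _)

  InM-⊗-topRows : ∀ {X} → InM k m X → ∀ Y → (X ⊗ topRows Y) ≈ᴹ topRows Y
  InM-⊗-topRows {X} X∈M Y i j with <-≤-connex (toℕ i) k
  ... | inj₁ i<k = begin
    (X ⊗ topRows Y) i j   ≈⟨ InM-⊗-topRows-diagonal X∈M Y i j ⟩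
    X i i * topRows Y i j ≈⟨ *-cong (proj₁ (X∈M i i) i<k i<k P.refl) refl ⟩
    1# * topRows Y i j    ≈⟨ *-identityˡ _ ⟩
    topRows Y i j         ∎
  ... | inj₂ k≤i = begin
    (X ⊗ topRows Y) i j   ≈⟨ InM-⊗-topRows-diagonal X∈M Y i j ⟩
    X i i * topRows Y i j ≈⟨ *-cong refl (topRows-≥ Y j k≤i) ⟩
    X i i * 0#            ≈⟨ zeroʳ _ ⟩
    0#                    ≈⟨ sym (topRows-≥ Y j k≤i) ⟩
    topRows Y i j         ∎

  topRows-InEM : ∀ {Y} → InM k m Y → InEM k m (topRows Y)
  topRows-InEM {Y} Y∈M = topRows-InM Y∈M , InM-⊗-topRows (topRows-InM Y∈M) Y

  topRows-⊗-idempotent : ∀ {Y} → Idempotent Y → (topRows Y ⊗ Y) ≈ᴹ topRows Y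
  topRows-⊗-idempotent {Y} Y²≈Y i j = trans (topRows-⊗ Y Y i j) (topRows-cong Y²≈Y i j)

  topRows-intertwines : ∀ {X Y} → InM k m X → Idempotent Y → (X ⊗ topRows Y) ≈ᴹ (topRows Y ⊗ Y)
  topRows-intertwines {X} {Y} X∈M Y²≈Y i j =
    trans (InM-⊗-topRows X∈M Y i j) (sym (topRows-⊗-idempotent Y²≈Y i j))

proposition7p4 : {c ℓ : Level} (F : Field c ℓ) → let open MatrixDefs F in
    (k m : ℕ) → 1 ≤ k → 1 ≤ m →
    (X Y : Mat (k + m)) → InEM k m X → InEM k m Y →
    Σ (Mat (k + m)) λ Z → Σ (Mat (k + m)) λ W →
      InEM k m Z × InEM k m W × ((X ⊗ Z) ≈ᴹ (Z ⊗ Y)) × ((Y ⊗ W) ≈ᴹ (W ⊗ X))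
proposition7p4 F k m _ _ X Y (X∈M , X²≈X) (Y∈M , Y²≈Y) =
    topRows Y , topRows X
  , topRows-InEM Y∈M , topRows-InEM X∈M
  , topRows-intertwines X∈M Y²≈Y , topRows-intertwines Y∈M X²≈X
  where open TopRows F k m
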